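{- Let $b_0,b_1,b_2,\dots$ be indeterminates, $B(x)=\sum_{i\ge0}b_ix^i$, and let $g(x)$ be the unique formal power series with $g(x)=1+xg(x)B(x^2g(x))$. For a positive integer $m$ and $n\ge1$ write $g_n^{(m)}=[x^n]g^m(x)$ and $p=\lfloor (n-1)/2\rfloor$. Then $$g_n^{(m)}=\sum \left(m\,|\,b_0^{m_0}b_1^{m_1}\cdots b_p^{m_p}\right)\,b_0^{m_0}b_1^{m_1}\cdots b_p^{m_p},$$ where the sum runs over all partitions of $n$ into odd parts, i.e. over all tuples $(m_0,\dots,m_p)$ of nonnegative integers with $n=\sum_{i=0}^p m_i(2i+1)$, the monomial $b_0^{m_0}\cdots b_p^{m_p}$ corresponding to the partition with $m_i$ parts equal to $2i+1$, and $\left(m\,|\,b_0^{m_0}\cdots b_p^{m_p}\right)$ is a numerical coefficient depending only on $m$ and the exponents.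
   Context: $[x^n]F(x)$ denotes the coefficient of $x^n$ in a power series $F$. The notation $\left(m\,|\,b_0^{m_0}b_1^{m_1}\cdots b_p^{m_p}\right)$ denotes the coefficient of the monomial $b_0^{m_0}\cdots b_p^{m_p}$ in the polynomial expansion of $g_n^{(m)}$ in terms of $b_0,b_1,\dots$. -}

module Defs where

open import Data.Nat using (ℕ; zero; suc; _+_; _*_; _∸_; _≟_; _/_; _≡ᵇ_; _≤ᵇ_)
open import Data.Nat.ListAction using (sum)
open import Data.List using (List; []; _∷_; map; concatMap; filter; upTo; _++_; replicate; foldr)
open import Data.Product using (_×_; _,_; proj₁; proj₂)
open import Data.Bool using (Bool; true; false; _∧_; if_then_else_)
open import Relation.Binary.PropositionalEquality using (_≡_)

-- A monomial b₀^a₀ b₁^a₁ ⋯ is its exponent list (a₀ ∷ a₁ ∷ …);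
-- lists differing only by trailing zeros denote the same monomial.
Mono : Set
Mono = List ℕ

monoMul : Mono → Mono → Mono
monoMul [] β = β
monoMul (a ∷ α) [] = a ∷ α
monoMul (a ∷ α) (b ∷ β) = (a + b) ∷ monoMul α β

isZero : ℕ → Bool
isZero zero = true
isZero (suc _) = false

monoEq : Mono → Mono → Bool
monoEq [] [] = true
monoEq [] (b ∷ β) = isZero b ∧ monoEq [] β
monoEq (a ∷ α) [] = isZero a ∧ monoEq α []
monoEq (a ∷ α) (b ∷ β) = (a ≡ᵇ b) ∧ monoEq α β

Poly : Set
Poly = List (ℕ × Mono)

coeff : Mono → Poly → ℕ
coeff α P = sum (map (λ t → if monoEq (proj₂ t) α then proj₁ t else 0) P)

infix 4 _≈_
_≈_ : Poly → Poly → Set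
P ≈ Q = ∀ α → coeff α P ≡ coeff α Q

polyAdd : Poly → Poly → Poly
polyAdd = _++_

polyMul : Poly → Poly → Poly
polyMul P Q = concatMap (λ s → map (λ t → (proj₁ s * proj₁ t , monoMul (proj₂ s) (proj₂ t))) Q) P

polyOne : Poly
polyOne = (1 , []) ∷ []

var : ℕ → Poly
var i = (1 , replicate i 0 ++ (1 ∷ [])) ∷ []

-- Formal power series in x over the polynomial ring: n ↦ [xⁿ]F.

Series : Set
Series = ℕ → Poly

sOne : Series
sOne zero = polyOne
sOne (suc _) = []

sMul : Series → Series → Series
sMul f h n = foldr polyAdd [] (map (λ j → polyMul (f j) (h (n ∸ j))) (upTo (suc n)))

sPow : Series → ℕ → Series
sPow f zero = sOne
sPow f (suc k) = sMul f (sPow f k)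

sShift : Series → Series
sShift f zero = []
sShift f (suc n) = f n

-- B(x² g(x)) = Σ_i b_i x^{2i} g(x)^i ; its coefficient of x^k
BComp : Series → Series
BComp g k = concatMap (λ i → if (2 * i) ≤ᵇ k then polyMul (var i) (sPow g i (k ∸ 2 * i)) else [])
                      (upTo (suc k))

gRHS : Series → Series
gRHS g n = polyAdd (sOne n) (sShift (sMul g (BComp g)) n)

IsG : Series → Set
IsG g = ∀ n → g n ≈ gRHS g n

gmn : Series → ℕ → ℕ → Poly
gmn g m n = sPow g m n

tuples : ℕ → ℕ → List Mono
tuples zero b = [] ∷ []
tuples (suc l) b = concatMap (λ a → map (a ∷_) (tuples l b)) (upTo (suc b))

weightFrom : ℕ → Mono → ℕ
weightFrom i [] = 0
weightFrom i (a ∷ α) = a * (2 * i + 1) + weightFrom (suc i) α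

weight : Mono → ℕ
weight = weightFrom 0

oddPartitions : ℕ → List Mono
oddPartitions n = filter (λ α → weight α ≟ n) (tuples (suc ((n ∸ 1) / 2)) n)

-- (m | b₀^{m₀}⋯b_p^{m_p}) : the coefficient of that monomial in g_n^{(m)}
-- Σ over odd partitions α of n of (m | b^α) b^α
oddPartitionSum : Poly → ℕ → Poly
oddPartitionSum P n = concatMap (λ α → (coeff α P , α) ∷ []) (oddPartitions n)

{-# OPTIONS --safe #-}
-- Give b_i the weight 2i+1. Since b_i x^{2i} g^i has weight one more than its x-degree, the
-- equation g = 1 + x g B(x² g) is homogeneous when x has weight 1, so by strong induction on n
-- every monomial of [xⁿ] g, and hence of [xⁿ] g^m, has weight n. The exponent vectors of
-- weight n are exactly the odd partitions of n, each enumerated once by oddPartitions n, so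
-- collecting the coefficients of g_n^{(m)} over them loses nothing.
module Submission where

open import Defs
open import Data.Nat using (ℕ; zero; suc; _+_; _*_; _∸_; _≤_; _<_; _≟_; _≡ᵇ_; _≤ᵇ_; _/_; z≤n; s≤s; z<s)
open import Data.Nat.Properties
open import Algebra.Properties.CommutativeSemigroup +-commutativeSemigroup using (interchange)
open import Data.Nat.DivMod using (m≡m%n+[m/n]*n; m%n<n)
open import Data.Nat.Induction using (<-rec)
open import Data.Nat.ListAction using (sum)
open import Data.Nat.ListAction.Properties using (sum-++)
open import Data.List using (List; []; _∷_; map; concatMap; filter; upTo; applyUpTo; _++_; replicate)
open import Data.List.Properties using (map-++; map-upTo)
open import Data.List.Relation.Unary.All using (All; []; _∷_)
import Data.List.Relation.Unary.All as All
open import Data.List.Relation.Unary.All.Properties using (concat⁺; map⁺; applyUpTo⁺₁)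
open import Data.Product using (_×_; _,_; proj₁; proj₂)
open import Data.Sum using (_⊎_; inj₁; inj₂)
open import Data.Bool using (true; false; _∧_; if_then_else_)
open import Data.Bool.Properties using (T-≡)
open import Data.Empty using (⊥-elim)
open import Function using (id; _∘_; Equivalence)
open import Relation.Nullary using (yes; no)
open import Relation.Unary using (Pred; Decidable)
open import Relation.Binary.PropositionalEquality

≡ᵇ-refl : ∀ n → (n ≡ᵇ n) ≡ true
≡ᵇ-refl n = Equivalence.to T-≡ (≡⇒≡ᵇ n n refl)

≡ᵇ-true⇒≡ : ∀ m n → (m ≡ᵇ n) ≡ true → m ≡ n
≡ᵇ-true⇒≡ m n e = ≡ᵇ⇒≡ m n (Equivalence.from T-≡ e)

exponent : Mono → ℕ → ℕ
exponent []      k       = 0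
exponent (a ∷ α) zero    = a
exponent (a ∷ α) (suc k) = exponent α k

dropFirstExponent : Mono → Mono
dropFirstExponent []      = []
dropFirstExponent (_ ∷ α) = α

monoEq⇒exponent≡ : ∀ α β → monoEq α β ≡ true → ∀ k → exponent α k ≡ exponent β k
monoEq⇒exponent≡ []           []           e k       = refl
monoEq⇒exponent≡ []           (zero ∷ β)   e zero    = refl
monoEq⇒exponent≡ []           (zero ∷ β)   e (suc k) = monoEq⇒exponent≡ [] β e k
monoEq⇒exponent≡ (zero ∷ α)   []           e zero    = refl
monoEq⇒exponent≡ (zero ∷ α)   []           e (suc k) = monoEq⇒exponent≡ α [] e k
monoEq⇒exponent≡ (a ∷ α)      (b ∷ β)      e k with a ≡ᵇ b in a≡ᵇb
monoEq⇒exponent≡ (a ∷ α)      (b ∷ β)      e zero    | true = ≡ᵇ-true⇒≡ a b a≡ᵇb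
monoEq⇒exponent≡ (a ∷ α)      (b ∷ β)      e (suc k) | true = monoEq⇒exponent≡ α β e k

exponent≡⇒monoEq : ∀ α β → (∀ k → exponent α k ≡ exponent β k) → monoEq α β ≡ true
exponent≡⇒monoEq []          []          eq = refl
exponent≡⇒monoEq []          (zero ∷ β)  eq = exponent≡⇒monoEq [] β (eq ∘ suc)
exponent≡⇒monoEq []          (suc b ∷ β) eq with () ← eq zero
exponent≡⇒monoEq (zero ∷ α)  []          eq = exponent≡⇒monoEq α [] (eq ∘ suc)
exponent≡⇒monoEq (suc a ∷ α) []          eq with () ← eq zero
exponent≡⇒monoEq (a ∷ α)     (b ∷ β)     eq rewrite eq zero | ≡ᵇ-refl b =
  exponent≡⇒monoEq α β (eq ∘ suc)

monoEq-refl : ∀ α → monoEq α α ≡ true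
monoEq-refl α = exponent≡⇒monoEq α α (λ _ → refl)

monoEq-trans : ∀ α β γ → monoEq α β ≡ true → monoEq β γ ≡ true → monoEq α γ ≡ true
monoEq-trans α β γ α≈β β≈γ = exponent≡⇒monoEq α γ λ k →
  trans (monoEq⇒exponent≡ α β α≈β k) (monoEq⇒exponent≡ β γ β≈γ k)

monoEq-sym : ∀ α β → monoEq α β ≡ true → monoEq β α ≡ true
monoEq-sym α β α≈β = exponent≡⇒monoEq β α λ k → sym (monoEq⇒exponent≡ α β α≈β k)

monoEq-respʳ : ∀ γ {β α} → monoEq β α ≡ true → monoEq γ β ≡ monoEq γ α
monoEq-respʳ γ {β} {α} β≈α with monoEq γ β in γ≈β | monoEq γ α in γ≈α
... | true  | true  = refl
... | false | false = refl
... | true  | false = trans (sym (monoEq-trans γ β α γ≈β β≈α)) γ≈α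
... | false | true  = trans (sym γ≈β) (monoEq-trans γ α β γ≈α (monoEq-sym β α β≈α))

monoEq-∷ : ∀ a β α → monoEq (a ∷ β) α ≡ (a ≡ᵇ exponent α 0) ∧ monoEq β (dropFirstExponent α)
monoEq-∷ zero    β []      = refl
monoEq-∷ (suc a) β []      = refl
monoEq-∷ a       β (_ ∷ α) = refl

coeff-resp-monoEq : ∀ {β α} P → monoEq β α ≡ true → coeff β P ≡ coeff α P
coeff-resp-monoEq []            β≈α = refl
coeff-resp-monoEq ((c , γ) ∷ P) β≈α =
  cong₂ _+_ (cong (λ b → if b then c else 0) (monoEq-respʳ γ β≈α)) (coeff-resp-monoEq P β≈α)

weightFrom-resp-monoEq : ∀ i α β → monoEq α β ≡ true → weightFrom i α ≡ weightFrom i β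
weightFrom-resp-monoEq i []         []         α≈β = refl
weightFrom-resp-monoEq i []         (zero ∷ β) α≈β = weightFrom-resp-monoEq (suc i) [] β α≈β
weightFrom-resp-monoEq i (zero ∷ α) []         α≈β = weightFrom-resp-monoEq (suc i) α [] α≈β
weightFrom-resp-monoEq i (a ∷ α)    (b ∷ β)    α≈β with a ≡ᵇ b in a≡ᵇb
... | true = cong₂ (λ c w → c * (2 * i + 1) + w)
                   (≡ᵇ-true⇒≡ a b a≡ᵇb) (weightFrom-resp-monoEq (suc i) α β α≈β)

weightFrom-∷ : ∀ i α →
  weightFrom i α ≡ exponent α 0 * (2 * i + 1) + weightFrom (suc i) (dropFirstExponent α)
weightFrom-∷ i []      = refl
weightFrom-∷ i (a ∷ α) = refl

weightFrom-monoMul : ∀ i α β → weightFrom i (monoMul α β) ≡ weightFrom i α + weightFrom i β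
weightFrom-monoMul i []      β       = refl
weightFrom-monoMul i (a ∷ α) []      = sym (+-identityʳ _)
weightFrom-monoMul i (a ∷ α) (b ∷ β) = begin
    (a + b) * k + weightFrom (suc i) (monoMul α β)
      ≡⟨ cong₂ _+_ (*-distribʳ-+ k a b) (weightFrom-monoMul (suc i) α β) ⟩
    (a * k + b * k) + (weightFrom (suc i) α + weightFrom (suc i) β)
      ≡⟨ interchange (a * k) (b * k) _ _ ⟩
    (a * k + weightFrom (suc i) α) + (b * k + weightFrom (suc i) β) ∎
  where
  open ≡-Reasoning
  k = 2 * i + 1

weightFrom-var : ∀ s i → weightFrom s (replicate i 0 ++ 1 ∷ []) ≡ 2 * (s + i) + 1
weightFrom-var s zero    = begin
    1 * (2 * s + 1) + 0 ≡⟨ +-identityʳ _ ⟩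
    1 * (2 * s + 1)     ≡⟨ *-identityˡ _ ⟩
    2 * s + 1           ≡⟨ cong (λ t → 2 * t + 1) (+-identityʳ s) ⟨
    2 * (s + 0) + 1     ∎
  where open ≡-Reasoning
weightFrom-var s (suc i) = trans (weightFrom-var (suc s) i) (cong (λ t → 2 * t + 1) (sym (+-suc s i)))

HomogeneousTerm : ℕ → ℕ × Mono → Set
HomogeneousTerm w (c , α) = c ≡ 0 ⊎ weight α ≡ w

Homogeneous : ℕ → Poly → Set
Homogeneous w = All (HomogeneousTerm w)

-- Homogeneity of the term list is what polyMul preserves; only the coefficientwise
-- VanishesOffWeight is invariant under ≈, which is how IsG is used.
VanishesOffWeight : ℕ → Poly → Set
VanishesOffWeight w P = ∀ α → weight α ≢ w → coeff α P ≡ 0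

homogeneous⇒vanishesOffWeight : ∀ {w} P → Homogeneous w P → VanishesOffWeight w P
homogeneous⇒vanishesOffWeight         []            []            α w≢ = refl
homogeneous⇒vanishesOffWeight {w} ((c , β) ∷ P) (homβ ∷ homP) α w≢ =
  cong₂ _+_ (head homβ) (homogeneous⇒vanishesOffWeight P homP α w≢)
  where
  head : HomogeneousTerm w (c , β) → (if monoEq β α then c else 0) ≡ 0
  head homβ with monoEq β α in β≈α
  ... | false = refl
  head (inj₁ c≡0)  | true = c≡0
  head (inj₂ wβ≡w) | true = ⊥-elim (w≢ (trans (sym (weightFrom-resp-monoEq 0 β α β≈α)) wβ≡w))

vanishesOffWeight⇒homogeneous : ∀ {w} P → VanishesOffWeight w P → Homogeneous w P
vanishesOffWeight⇒homogeneous     []            van = []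
vanishesOffWeight⇒homogeneous {w} ((c , β) ∷ P) van = head ∷ vanishesOffWeight⇒homogeneous P tail
  where
  head : HomogeneousTerm w (c , β)
  head with weight β ≟ w
  ... | yes wβ≡w = inj₂ wβ≡w
  ... | no  wβ≢w = inj₁ (m+n≡0⇒m≡0 c
    (subst (λ b → (if b then c else 0) + coeff β P ≡ 0) (monoEq-refl β) (van β wβ≢w)))
  tail : VanishesOffWeight w P
  tail α wα≢w = m+n≡0⇒n≡0 _ (van α wα≢w)

polyMul-homogeneous : ∀ {a b} P Q → Homogeneous a P → Homogeneous b Q →
                      Homogeneous (a + b) (polyMul P Q)
polyMul-homogeneous P Q homP homQ =
  concat⁺ (map⁺ (All.map (λ {s} homs → map⁺ (All.map (λ {t} → termMul s t homs) homQ)) homP))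
  where
  termMul : ∀ {a b} s t → HomogeneousTerm a s → HomogeneousTerm b t →
            HomogeneousTerm (a + b) (proj₁ s * proj₁ t , monoMul (proj₂ s) (proj₂ t))
  termMul (c , β) (d , γ) (inj₁ refl) _           = inj₁ refl
  termMul (c , β) (d , γ) (inj₂ _)    (inj₁ refl) = inj₁ (*-zeroʳ c)
  termMul (c , β) (d , γ) (inj₂ wβ)   (inj₂ wγ)   =
    inj₂ (trans (weightFrom-monoMul 0 β γ) (cong₂ _+_ wβ wγ))

var-homogeneous : ∀ i → Homogeneous (2 * i + 1) (var i)
var-homogeneous i = inj₂ (weightFrom-var 0 i) ∷ []

sOne-homogeneous : ∀ n → Homogeneous n (sOne n)
sOne-homogeneous zero    = inj₂ refl ∷ []
sOne-homogeneous (suc n) = []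

GradedUpTo : ℕ → Series → ℕ → Set
GradedUpTo d f n = ∀ k → k ≤ n → Homogeneous (d + k) (f k)

sMul-graded : ∀ {c d f h n} → GradedUpTo c f n → GradedUpTo d h n →
              GradedUpTo (c + d) (sMul f h) n
sMul-graded {c} {d} {f} {h} gradedf gradedh k k≤n = concat⁺ (map⁺ (applyUpTo⁺₁ id (suc k) term))
  where
  term : ∀ {j} → j < suc k → Homogeneous (c + d + k) (polyMul (f j) (h (k ∸ j)))
  term {j} (s≤s j≤k) = subst (λ w → Homogeneous w (polyMul (f j) (h (k ∸ j))))
    (trans (interchange c j d (k ∸ j)) (cong (c + d +_) (m+[n∸m]≡n j≤k)))
    (polyMul-homogeneous (f j) (h (k ∸ j))
      (gradedf j (≤-trans j≤k k≤n)) (gradedh (k ∸ j) (≤-trans (m∸n≤m k j) k≤n)))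

sPow-graded : ∀ {f n} → GradedUpTo 0 f n → ∀ i → GradedUpTo 0 (sPow f i) n
sPow-graded gradedf zero    k _ = sOne-homogeneous k
sPow-graded gradedf (suc i)     = sMul-graded gradedf (sPow-graded gradedf i)

BComp-graded : ∀ {g n} → GradedUpTo 0 g n → GradedUpTo 1 (BComp g) n
BComp-graded {g} gradedg k k≤n = concat⁺ (map⁺ (All.universal term (upTo (suc k))))
  where
  term : ∀ i →
    Homogeneous (suc k) (if 2 * i ≤ᵇ k then polyMul (var i) (sPow g i (k ∸ 2 * i)) else [])
  term i with 2 * i ≤ᵇ k in 2i≤ᵇk
  ... | false = []
  ... | true  = subst (λ w → Homogeneous w (polyMul (var i) (sPow g i (k ∸ 2 * i))))
    (cong suc (m+[n∸m]≡n (≤ᵇ⇒≤ (2 * i) k (Equivalence.from T-≡ 2i≤ᵇk))))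
    (polyMul-homogeneous (var i) _
      (subst (λ w → Homogeneous w (var i)) (+-comm (2 * i) 1) (var-homogeneous i))
      (sPow-graded gradedg i (k ∸ 2 * i) (≤-trans (m∸n≤m k (2 * i)) k≤n)))

gRHS-homogeneous : ∀ {g} n → (∀ {k} → k < n → Homogeneous k (g k)) → Homogeneous n (gRHS g n)
gRHS-homogeneous     zero    below = inj₂ refl ∷ []
gRHS-homogeneous {g} (suc n) below = sMul-graded gradedg (BComp-graded gradedg) n ≤-refl
  where
  gradedg : GradedUpTo 0 g n
  gradedg k k≤n = below (s≤s k≤n)

IsG⇒homogeneous : ∀ g → IsG g → ∀ n → Homogeneous n (g n)
IsG⇒homogeneous g isG = <-rec (λ n → Homogeneous n (g n)) λ n below →
  vanishesOffWeight⇒homogeneous (g n) λ α wα≢n →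
    trans (isG n α) (homogeneous⇒vanishesOffWeight (gRHS g n) (gRHS-homogeneous n below) α wα≢n)

gmn-vanishesOffWeight : ∀ g → IsG g → ∀ m n → VanishesOffWeight n (gmn g m n)
gmn-vanishesOffWeight g isG m n =
  homogeneous⇒vanishesOffWeight (gmn g m n)
    (sPow-graded (λ k _ → IsG⇒homogeneous g isG k) m n ≤-refl)

matches : Mono → Mono → ℕ
matches α β = if monoEq β α then 1 else 0

multiplicity : Mono → List Mono → ℕ
multiplicity α L = sum (map (matches α) L)

multiplicity-++ : ∀ α A B → multiplicity α (A ++ B) ≡ multiplicity α A + multiplicity α B
multiplicity-++ α A B =
  trans (cong sum (map-++ (matches α) A B)) (sum-++ (map (matches α) A) (map (matches α) B))

multiplicity-concatMap : ∀ {A : Set} α (f : A → List Mono) L →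
                         multiplicity α (concatMap f L) ≡ sum (map (multiplicity α ∘ f) L)
multiplicity-concatMap α f []      = refl
multiplicity-concatMap α f (x ∷ L) =
  trans (multiplicity-++ α (f x) (concatMap f L))
        (cong (multiplicity α (f x) +_) (multiplicity-concatMap α f L))

multiplicity-map-∷ : ∀ α L →
  multiplicity α (map (exponent α 0 ∷_) L) ≡ multiplicity (dropFirstExponent α) L
multiplicity-map-∷ α []      = refl
multiplicity-map-∷ α (β ∷ L)
  rewrite monoEq-∷ (exponent α 0) β α | ≡ᵇ-refl (exponent α 0) = cong (_ +_) (multiplicity-map-∷ α L)

multiplicity-map-∷-≢ : ∀ {a} α L → a ≢ exponent α 0 → multiplicity α (map (a ∷_) L) ≡ 0
multiplicity-map-∷-≢     α []      a≢ = refl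
multiplicity-map-∷-≢ {a} α (β ∷ L) a≢ rewrite monoEq-∷ a β α with a ≡ᵇ exponent α 0 in a≡ᵇα₀
... | true  = ⊥-elim (a≢ (≡ᵇ-true⇒≡ a (exponent α 0) a≡ᵇα₀))
... | false = multiplicity-map-∷-≢ α L a≢

multiplicity-filter : ∀ {p} {P : Pred Mono p} (P? : Decidable P) α L →
                      (∀ β → monoEq β α ≡ true → P β) →
                      multiplicity α (filter P? L) ≡ multiplicity α L
multiplicity-filter P? α []      P≈ = refl
multiplicity-filter P? α (β ∷ L) P≈ with P? β
... | yes _ = cong (_ +_) (multiplicity-filter P? α L P≈)
... | no ¬Pβ with monoEq β α in β≈α
...   | true  = ⊥-elim (¬Pβ (P≈ β β≈α))
...   | false = multiplicity-filter P? α L P≈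

sum-applyUpTo-zero : ∀ (h : ℕ → ℕ) n → (∀ i → h i ≡ 0) → sum (applyUpTo h n) ≡ 0
sum-applyUpTo-zero h zero    h≡0 = refl
sum-applyUpTo-zero h (suc n) h≡0 = cong₂ _+_ (h≡0 0) (sum-applyUpTo-zero (h ∘ suc) n (h≡0 ∘ suc))

sum-applyUpTo-single : ∀ (h : ℕ → ℕ) {x} n → x < n → (∀ i → i ≢ x → h i ≡ 0) →
                       sum (applyUpTo h n) ≡ h x
sum-applyUpTo-single h (suc n) (s≤s z≤n) h≡0 =
  trans (cong (h 0 +_) (sum-applyUpTo-zero (h ∘ suc) n (λ i → h≡0 (suc i) λ ()))) (+-identityʳ (h 0))
sum-applyUpTo-single h (suc n) (s≤s (s≤s x<n)) h≡0 =
  cong₂ _+_ (h≡0 0 λ ())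
    (sum-applyUpTo-single (h ∘ suc) n (s≤s x<n) (λ i i≢x → h≡0 (suc i) (i≢x ∘ suc-injective)))

weightFrom<⇒monoEq-[] : ∀ i α → weightFrom i α < 2 * i + 1 → monoEq [] α ≡ true
weightFrom<⇒monoEq-[] i []          _ = refl
weightFrom<⇒monoEq-[] i (zero ∷ α)  w< =
  weightFrom<⇒monoEq-[] (suc i) α (<-≤-trans w< (+-monoˡ-≤ 1 (*-monoʳ-≤ 2 (n≤1+n i))))
weightFrom<⇒monoEq-[] i (suc a ∷ α) w< = ⊥-elim (<-irrefl refl (≤-<-trans k≤w w<))
  where
  k≤w : 2 * i + 1 ≤ weightFrom i (suc a ∷ α)
  k≤w = ≤-trans (m≤m+n (2 * i + 1) (a * (2 * i + 1))) (m≤m+n _ (weightFrom (suc i) α))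

exponent₀≤weightFrom : ∀ i α → exponent α 0 ≤ weightFrom i α
exponent₀≤weightFrom i α = begin
    a                                                  ≤⟨ m≤m*n a (suc (2 * i)) ⟩
    a * suc (2 * i)                                    ≡⟨ cong (a *_) (+-comm 1 (2 * i)) ⟩
    a * (2 * i + 1)                                    ≤⟨ m≤m+n _ _ ⟩
    a * (2 * i + 1) + weightFrom (suc i) (dropFirstExponent α) ≡⟨ weightFrom-∷ i α ⟨
    weightFrom i α                                     ∎
  where
  open ≤-Reasoning
  a = exponent α 0

weightFrom-dropFirstExponent≤ : ∀ i α → weightFrom (suc i) (dropFirstExponent α) ≤ weightFrom i α
weightFrom-dropFirstExponent≤ i α = ≤-trans (m≤n+m _ _) (≤-reflexive (sym (weightFrom-∷ i α)))

-- The two bounds say that, up to trailing zeros, α is an l-tuple with entries at most b.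
multiplicity-tuples : ∀ l i b α → weightFrom i α ≤ b → b < 2 * (i + l) + 1 →
                      multiplicity α (tuples l b) ≡ 1
multiplicity-tuples zero i b α w≤b b<
  rewrite weightFrom<⇒monoEq-[] i α (≤-<-trans w≤b (subst (λ j → b < 2 * j + 1) (+-identityʳ i) b<))
  = refl
multiplicity-tuples (suc l) i b α w≤b b< = begin
    multiplicity α (concatMap (λ a → map (a ∷_) Ts) (upTo (suc b)))
      ≡⟨ multiplicity-concatMap α (λ a → map (a ∷_) Ts) (upTo (suc b)) ⟩
    sum (map (λ a → multiplicity α (map (a ∷_) Ts)) (upTo (suc b)))
      ≡⟨ cong sum (map-upTo _ (suc b)) ⟩
    sum (applyUpTo (λ a → multiplicity α (map (a ∷_) Ts)) (suc b))
      ≡⟨ sum-applyUpTo-single _ (suc b) (s≤s (≤-trans (exponent₀≤weightFrom i α) w≤b))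
           (λ a a≢ → multiplicity-map-∷-≢ α Ts a≢) ⟩
    multiplicity α (map (exponent α 0 ∷_) Ts)
      ≡⟨ multiplicity-map-∷ α Ts ⟩
    multiplicity (dropFirstExponent α) Ts
      ≡⟨ multiplicity-tuples l (suc i) b (dropFirstExponent α)
           (≤-trans (weightFrom-dropFirstExponent≤ i α) w≤b)
           (subst (λ j → b < 2 * j + 1) (+-suc i l) b<) ⟩
    1 ∎
  where
  open ≡-Reasoning
  Ts = tuples l b

n<2*[1+[n∸1]/2]+1 : ∀ n → n < 2 * suc ((n ∸ 1) / 2) + 1
n<2*[1+[n∸1]/2]+1 n = begin-strict
    n             ≤⟨ m≤n+m∸n n 1 ⟩
    1 + q         ≤⟨ +-monoʳ-≤ 1 q≤1+p*2 ⟩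
    2 + p * 2     ≡⟨ trans (cong (2 +_) (*-comm p 2)) (sym (*-suc 2 p)) ⟩
    2 * suc p     <⟨ m<m+n (2 * suc p) z<s ⟩
    2 * suc p + 1 ∎
  where
  open ≤-Reasoning
  q = n ∸ 1
  p = q / 2
  q≤1+p*2 : q ≤ 1 + p * 2
  q≤1+p*2 = ≤-trans (≤-reflexive (m≡m%n+[m/n]*n q 2)) (+-monoˡ-≤ (p * 2) (<⇒≤pred (m%n<n q 2)))

multiplicity-oddPartitions : ∀ α n → weight α ≡ n → multiplicity α (oddPartitions n) ≡ 1
multiplicity-oddPartitions α n wα≡n = trans
  (multiplicity-filter (λ β → weight β ≟ n) α (tuples l n)
    (λ β β≈α → trans (weightFrom-resp-monoEq 0 β α β≈α) wα≡n))
  (multiplicity-tuples l 0 n α (≤-reflexive wα≡n) (n<2*[1+[n∸1]/2]+1 n))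
  where
  l = suc ((n ∸ 1) / 2)

coeff-concatMap-terms : ∀ α P L →
  coeff α (concatMap (λ β → (coeff β P , β) ∷ []) L) ≡ multiplicity α L * coeff α P
coeff-concatMap-terms α P []      = refl
coeff-concatMap-terms α P (β ∷ L) =
  trans (cong₂ _+_ head (coeff-concatMap-terms α P L)) (sym (*-distribʳ-+ (coeff α P) (matches α β) _))
  where
  head : (if monoEq β α then coeff β P else 0) ≡ matches α β * coeff α P
  head with monoEq β α in β≈α
  ... | true  = trans (coeff-resp-monoEq P β≈α) (sym (+-identityʳ _))
  ... | false = refl

theorem3 : (g : Series) → IsG g → (m n : ℕ) → 1 ≤ m → 1 ≤ n →
    gmn g m n ≈ oddPartitionSum (gmn g m n) n
theorem3 g isG m n _ _ α = begin
    coeff α P                                    ≡⟨ coeff≡multiplicity*coeff ⟩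
    multiplicity α (oddPartitions n) * coeff α P ≡⟨ coeff-concatMap-terms α P (oddPartitions n) ⟨
    coeff α (oddPartitionSum P n)                ∎
  where
  open ≡-Reasoning
  P = gmn g m n
  coeff≡multiplicity*coeff : coeff α P ≡ multiplicity α (oddPartitions n) * coeff α P
  coeff≡multiplicity*coeff with weight α ≟ n
  ... | yes wα≡n rewrite multiplicity-oddPartitions α n wα≡n = sym (*-identityˡ (coeff α P))
  ... | no  wα≢n rewrite gmn-vanishesOffWeight g isG m n α wα≢n = sym (*-zeroʳ (multiplicity α (oddPartitions n)))
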